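{- The following are equivalent: (1) for every maximal ideal $\mathcal{I}$ on $\omega$ (the dual of a nonprincipal ultrafilter), either $\mathcal{I}\leq_{\mathsf{K}}\mathsf{nwd}$ or there is $X\in\mathcal{I}^+$ with $\mathcal{ED}\leq_{\mathsf{K}}\mathcal{I}\upharpoonright X$; (2) there are no Ramsey ultrafilters.
   Context: An ideal on $S$ contains $\emptyset$, not $S$, closed under subsets and finite unions; $\mathcal{I}^+=\mathcal{P}(S)\setminus\mathcal{I}$, $\mathcal{I}\upharpoonright X=\mathcal{P}(X)\cap\mathcal{I}$. For an ultrafilter $\mathcal{U}$, $\mathcal{U}^*=\{\omega\setminus U:U\in\mathcal{U}\}$. $\mathcal{J}\leq_{\mathsf{K}}\mathcal{I}$ means there is $f$ from the underlying set of $\mathcal{I}$ to that of $\mathcal{J}$ with $f^{ -1}(A)\in\mathcal{I}$ for all $A\in\mathcal{J}$. $\mathsf{nwd}$: nowhere dense subsets of $\mathbb{Q}$. $\mathcal{ED}$: ideal on $\omega\times\omega$ generated by columns $\{n\}\times\omega$ and graphs of functions $\omega\to\omega$. An ideal is $\mathsf{P}^+$ if every $\subseteq$-decreasing $\{X_n\}\subseteq\mathcal{I}^+$ has a pseudointersection in $\mathcal{I}^+$; $\mathsf{Q}^+$ if for every $X\in\mathcal{I}^+$ and partition of $X$ into finite sets $P_n$ there is $A\in\mathcal{I}^+$, $A\subseteq X$, with $|A\cap P_n|\leq1$ for all $n$; selective if both. A nonprincipal ultrafilter $\mathcal{U}$ is Ramsey if $\mathcal{U}^*$ is selective. -}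

module Defs where

open import Level using (0ℓ)
open import Data.Bool using (Bool; true; false; _∨_; not)
open import Data.Nat using (ℕ; _≥_)
open import Data.Product using (Σ; Σ-syntax; _×_; _,_)
open import Data.Sum using (_⊎_)
open import Data.List using (List)
open import Data.List.Membership.Propositional using (_∈_)
open import Data.List.Relation.Unary.Any using (Any)
open import Data.Rational using (ℚ; _<_; _≤_)
open import Relation.Binary.PropositionalEquality using (_≡_; _≢_; refl)
open import Relation.Nullary using (¬_)

-- Subsets of a set S are characteristic functions S → Bool
-- (with excluded middle, equivalent to arbitrary subsets).
Subset : Set → Set
Subset S = S → Bool

_∈ₛ_ : {S : Set} → S → Subset S → Set
x ∈ₛ A = A x ≡ true

_⊆_ : {S : Set} → Subset S → Subset S → Set
A ⊆ B = ∀ x → x ∈ₛ A → x ∈ₛ B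

∅ₛ : {S : Set} → Subset S
∅ₛ _ = false

fullₛ : {S : Set} → Subset S
fullₛ _ = true

_∪_ : {S : Set} → Subset S → Subset S → Subset S
(A ∪ B) x = A x ∨ B x

compl : {S : Set} → Subset S → Subset S
compl A x = not (A x)

Family : Set → Set₁
Family S = Subset S → Set

record IsIdeal {S : Set} (I : Family S) : Set₁ where
  field
    empty∈ : I ∅ₛ
    full∉  : ¬ I fullₛ
    down   : ∀ A B → A ⊆ B → I B → I A
    union  : ∀ A B → I A → I B → I (A ∪ B)

Pos : {S : Set} → Family S → Family S
Pos I A = ¬ I A

El : Subset ℕ → Set
El X = Σ ℕ λ n → X n ≡ true

extendAux : (X : Subset ℕ) → Subset (El X) → (n : ℕ) → (b : Bool) → X n ≡ b → Bool
extendAux X B n true  p = B (n , p)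
extendAux X B n false _ = false

extend : (X : Subset ℕ) → Subset (El X) → Subset ℕ
extend X B n = extendAux X B n (X n) refl

_↾_ : Family ℕ → (X : Subset ℕ) → Family (El X)
(I ↾ X) B = I (extend X B)

_≤K_ : {S T : Set} → Family T → Family S → Set
_≤K_ {S} {T} J I = Σ (S → T) λ f → ∀ (A : Subset T) → J A → I (λ x → A (f x))

Finite : Subset ℕ → Set
Finite A = Σ ℕ λ m → ∀ k → k ≥ m → A k ≡ false

nwd : Family ℚ
nwd A = ∀ (p q : ℚ) → p < q →
  Σ ℚ λ r → Σ ℚ λ s → p ≤ r × r < s × s ≤ q ×
    (∀ x → r < x → x < s → A x ≡ false)

ED : Family (ℕ × ℕ)
ED A = Σ (List ℕ) λ cols → Σ (List (ℕ → ℕ)) λ fs →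
  ∀ i j → A (i , j) ≡ true → (i ∈ cols) ⊎ Any (λ f → f i ≡ j) fs

record IsNonprincipalUltrafilter (U : Family ℕ) : Set₁ where
  field
    full∈    : U fullₛ
    empty∉   : ¬ U ∅ₛ
    up       : ∀ A B → A ⊆ B → U A → U B
    inter    : ∀ A B → U A → U B → U (λ n → Data.Bool._∧_ (A n) (B n))
    ultra    : ∀ A → U A ⊎ U (compl A)
    nonprinc : ∀ n → ¬ U (λ k → Data.Nat._≡ᵇ_ k n)

dual : Family ℕ → Family ℕ
dual U A = U (compl A)

IsPPlus : Family ℕ → Set
IsPPlus I = ∀ (X : ℕ → Subset ℕ) →
  (∀ n → Pos I (X n)) → (∀ n → X (Data.Nat.suc n) ⊆ X n) →
  Σ (Subset ℕ) λ Y → Pos I Y ×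
    (∀ n → Finite (λ k → Data.Bool._∧_ (Y k) (not (X n k))))

IsQPlus : Family ℕ → Set
IsQPlus I = ∀ (X : Subset ℕ) (P : ℕ → Subset ℕ) → Pos I X →
  (∀ n → Finite (P n)) →
  (∀ n n' k → n ≢ n' → P n k ≡ true → P n' k ≡ true → Data.Empty.⊥) →
  (∀ k → X k ≡ true → Σ ℕ λ n → P n k ≡ true) →
  (∀ n → P n ⊆ X) →
  Σ (Subset ℕ) λ A → Pos I A × A ⊆ X ×
    (∀ n k k' → A k ≡ true → A k' ≡ true → P n k ≡ true → P n k' ≡ true → k ≡ k')
  where import Data.Empty

IsSelective : Family ℕ → Set
IsSelective I = IsPPlus I × IsQPlus I

IsRamsey : Family ℕ → Set₁
IsRamsey U = IsNonprincipalUltrafilter U × IsSelective (dual U)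

{-# OPTIONS --safe #-}
-- A maximal ideal I = U* contains the finite sets, so if f : ℚ → ω pulls I back into nwd,
-- f is unbounded on every rational interval. Diagonalising over an enumeration of the
-- intervals gives A ⊆ ω such that f⁻¹(A) and f⁻¹(ω ∖ A) both meet every interval; but one
-- of A, ω ∖ A lies in I. Hence U* ≰K nwd, and (1) says that ED ≤K U*↾X for some X ∈ U.
--
-- For an ideal I and X ∈ I⁺, ED ≤K I↾X holds exactly when some c : X → ω has all fibres in I
-- but is injective on no I-positive set: send k to (c k , k), and conversely take the first
-- coordinate of the Katětov map. A selective ideal admits no such c, since P⁺ makes c
-- finite-to-one on a positive set and Q⁺ then injective on a smaller one. Conversely, such
-- a c is the partition index when U* is not Q⁺, and k ↦ (the first n with k ∉ Xₙ) when U* is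
-- not P⁺. So (1) holds iff no U* is selective, i.e. there is no Ramsey ultrafilter.
module Submission where

open import Defs
open import Level using (0ℓ)
open import Axiom.ExcludedMiddle using (ExcludedMiddle)
open import Axiom.DoubleNegationElimination using (em⇒dne)
open import Data.Bool using (Bool; true; false; _∧_; _∨_; not)
open import Data.Bool.Properties using (¬-not; not-¬; ∨-zeroʳ; not-involutive)
open import Data.Nat
  using (ℕ; zero; suc; _≤_; _<_; _≤′_; ≤′-refl; ≤′-step; z≤n; s≤s; _≡ᵇ_; _≤ᵇ_; _⊔_; _+_)
open import Data.Nat.Properties
  using (_≟_; _≤?_; ≤-refl; ≤-trans; <-trans; <⇒≤; <⇒≢; <⇒≱; ≰⇒>; ≤-<-trans; <-≤-trans; ≤⇒≤′;
         m≤n⇒m<n∨m≡n; 1+n≰n; m≤m⊔n; m≤n⊔m; +-suc; +-identityʳ; suc-injective)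
open import Data.Integer using (ℤ; +_; -[1+_]; _⊖_)
open import Data.Integer.Properties using (⊖-≥)
open import Data.Rational using (ℚ; _/_; ↥_; 0ℚ; 1ℚ) renaming (_<_ to _<ℚ_)
import Data.Rational.Properties as ℚP
open import Data.Product using (Σ; _×_; _,_; proj₁; proj₂; uncurry)
open import Data.Sum using (_⊎_; inj₁; inj₂; [_,_]′)
open import Data.Empty using (⊥; ⊥-elim)
open import Data.List using (List; []; _∷_; upTo)
open import Data.List.Relation.Unary.Any as Any using (Any; here; there)
open import Data.List.Membership.Propositional.Properties using (∈-upTo⁺)
open import Function using (id; _∘_; const)
open import Function.Bundles using (_⇔_; mk⇔)
open import Relation.Nullary using (¬_; Dec; yes; no; does; contradiction)
open import Relation.Nullary.Decidable using (dec-true; dec-false)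
open import Relation.Binary.PropositionalEquality using (_≡_; _≢_; ≢-sym; refl; sym; trans; cong; cong₂; subst)

∧-intro : ∀ {a b} → a ≡ true → b ≡ true → a ∧ b ≡ true
∧-intro refl refl = refl

∧-elim : ∀ {a b} → a ∧ b ≡ true → a ≡ true × b ≡ true
∧-elim {true} b≡true = refl , b≡true

∨-introˡ : ∀ {a} b → a ≡ true → a ∨ b ≡ true
∨-introˡ _ refl = refl

∨-introʳ : ∀ a {b} → b ≡ true → a ∨ b ≡ true
∨-introʳ a refl = ∨-zeroʳ a

∨-false : ∀ {a b} → a ≡ false → b ≡ false → a ∨ b ≡ false
∨-false refl refl = refl

not-true : ∀ {a} → not a ≡ true → a ≡ false
not-true {false} _ = refl

not-false : ∀ {a} → not a ≡ false → a ≡ true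
not-false {true} _ = refl

does⇒ : ∀ {P : Set} (P? : Dec P) → does P? ≡ true → P
does⇒ (yes p) _ = p

infixl 25 _∩_ _∖_

_∩_ : {S : Set} → Subset S → Subset S → Subset S
(A ∩ B) x = A x ∧ B x

_∖_ : {S : Set} → Subset S → Subset S → Subset S
(A ∖ B) x = A x ∧ not (B x)

⋃ : {A S : Set} → (A → Subset S) → List A → Subset S
⋃ F []       = ∅ₛ
⋃ F (a ∷ as) = F a ∪ ⋃ F as

∈-⋃ : ∀ {A S : Set} {F : A → Subset S} {x} as → Any (λ a → x ∈ₛ F a) as → x ∈ₛ ⋃ F as
∈-⋃ (a ∷ as) (here x∈Fa)    = ∨-introˡ _ x∈Fa
∈-⋃ {F = F} {x} (a ∷ as) (there x∈⋃) = ∨-introʳ (F a x) (∈-⋃ as x∈⋃)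

fibre : (ℕ → ℕ) → ℕ → Subset ℕ
fibre c n k = c k ≡ᵇ n

InjectiveOn : (ℕ → ℕ) → Subset ℕ → Set
InjectiveOn c S = ∀ k k′ → k ∈ₛ S → k′ ∈ₛ S → c k ≡ c k′ → k ≡ k′

FiniteToOneOn : (ℕ → ℕ) → Subset ℕ → Set
FiniteToOneOn c S = ∀ n → Finite (S ∩ fibre c n)

IsMaximal : Family ℕ → Set
IsMaximal I = ∀ A → I A ⊎ I (compl A)

ED≤K↾Pos : Family ℕ → Set
ED≤K↾Pos I = Σ (Subset ℕ) λ X → Pos I X × (ED ≤K (I ↾ X))

column : ℕ → Subset (ℕ × ℕ)
column n p = proj₁ p ≡ᵇ n

graph : (ℕ → ℕ) → Subset (ℕ × ℕ)
graph g p = g (proj₁ p) ≡ᵇ proj₂ p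

column∈ED : ∀ n → ED (column n)
column∈ED n = n ∷ [] , [] , λ i j i∈col → inj₁ (here (does⇒ (i ≟ n) i∈col))

graph∈ED : ∀ g → ED (graph g)
graph∈ED g = [] , g ∷ [] , λ i j ij∈graph → inj₂ (here (does⇒ (g i ≟ j) ij∈graph))

extend-elim : ∀ X (B : Subset (El X)) k → k ∈ₛ extend X B → Σ (k ∈ₛ X) λ k∈X → (k , k∈X) ∈ₛ B
extend-elim X B k = go (X k) refl
  where
  go : ∀ b (X[k]≡b : X k ≡ b) → extendAux X B k b X[k]≡b ≡ true → Σ (k ∈ₛ X) λ k∈X → (k , k∈X) ∈ₛ B
  go true  k∈X k∈B = k∈X , k∈B
  go false _   ()

totaliseAux : ∀ {T : Set} X → T → (El X → T) → (k : ℕ) (b : Bool) → X k ≡ b → T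
totaliseAux X d f k true  k∈X = f (k , k∈X)
totaliseAux X d f k false _   = d

totalise : ∀ {T : Set} X → T → (El X → T) → ℕ → T
totalise X d f k = totaliseAux X d f k (X k) refl

totalise-spec : ∀ {T : Set} X d (f : El X → T) (Q : ℕ → T → Set) →
                (∀ e → Q (proj₁ e) (f e)) → ∀ k → k ∈ₛ X → Q k (totalise X d f k)
totalise-spec X d f Q spec k = go (X k) refl
  where
  go : ∀ b (X[k]≡b : X k ≡ b) → b ≡ true → Q k (totaliseAux X d f k b X[k]≡b)
  go true  k∈X _ = spec (k , k∈X)
  go false _   ()

extend-totalise : ∀ {T : Set} X d (f : El X → T) (A : Subset T) k →
                  extend X (A ∘ f) k ≡ (X ∩ (A ∘ totalise X d f)) k
extend-totalise X d f A k = go (X k) refl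
  where
  go : ∀ b (X[k]≡b : X k ≡ b) → extendAux X (A ∘ f) k b X[k]≡b ≡ (b ∧ A (totaliseAux X d f k b X[k]≡b))
  go true  _ = refl
  go false _ = refl

Finite-isIdeal : IsIdeal Finite
Finite-isIdeal = record
  { empty∈ = 0 , λ _ _ → refl
  ; full∉  = λ (m , beyond) → not-¬ refl (beyond m ≤-refl)
  ; down   = λ A B A⊆B (m , beyond) → m , λ k m≤k → ¬-not λ k∈A → not-¬ (A⊆B k k∈A) (beyond k m≤k)
  ; union  = λ A B (m , A-beyond) (m′ , B-beyond) → m ⊔ m′ , λ k m⊔m′≤k →
               ∨-false (A-beyond k (≤-trans (m≤m⊔n m m′) m⊔m′≤k))
                       (B-beyond k (≤-trans (m≤n⊔m m m′) m⊔m′≤k))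
  }

Minimum : (ℕ → Bool) → Set
Minimum p = Σ ℕ λ m → p m ≡ true × (∀ n → p n ≡ true → m ≤ n)

minimum : (p : ℕ → Bool) → ∀ n → p n ≡ true → Minimum p
minimum p zero    p0 = 0 , p0 , λ _ _ → z≤n
minimum p (suc n) pn with p 0 in p0
... | true  = 0 , p0 , λ _ _ → z≤n
... | false = shift (minimum (p ∘ suc) n pn)
  where
  shift : Minimum (p ∘ suc) → Minimum p
  shift (m , pm , least) = suc m , pm , below
    where
    below : ∀ k → p k ≡ true → suc m ≤ k
    below zero    p0≡true = contradiction p0 (not-¬ p0≡true)
    below (suc k) pk      = s≤s (least k pk)

Q⁺⇒injectiveOn : ∀ {I} → IsQPlus I → ∀ {Y} → Pos I Y → (c : ℕ → ℕ) → FiniteToOneOn c Y →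
                 Σ (Subset ℕ) λ A → Pos I A × A ⊆ Y × InjectiveOn c A
Q⁺⇒injectiveOn {I} qplus {Y} posY c finite-fibres =
  select (qplus Y (λ n → Y ∩ fibre c n) posY finite-fibres disjoint covers (λ n k → proj₁ ∘ ∧-elim))
  where
  on-fibre : ∀ {n k} → k ∈ₛ (Y ∩ fibre c n) → c k ≡ n
  on-fibre {n} {k} k∈ = does⇒ (c k ≟ n) (proj₂ (∧-elim {Y k} k∈))

  disjoint : ∀ n n′ k → n ≢ n′ → k ∈ₛ (Y ∩ fibre c n) → k ∈ₛ (Y ∩ fibre c n′) → ⊥
  disjoint n n′ k n≢n′ k∈ k∈′ = n≢n′ (trans (sym (on-fibre k∈)) (on-fibre k∈′))

  covers : ∀ k → k ∈ₛ Y → Σ ℕ λ n → k ∈ₛ (Y ∩ fibre c n)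
  covers k k∈Y = c k , ∧-intro k∈Y (dec-true (c k ≟ c k) refl)

  select : (Σ (Subset ℕ) λ A → Pos I A × A ⊆ Y ×
             (∀ n k k′ → k ∈ₛ A → k′ ∈ₛ A → k ∈ₛ (Y ∩ fibre c n) → k′ ∈ₛ (Y ∩ fibre c n) → k ≡ k′)) →
           Σ (Subset ℕ) λ A → Pos I A × A ⊆ Y × InjectiveOn c A
  select (A , posA , A⊆Y , selects) = A , posA , A⊆Y , λ k k′ k∈A k′∈A ck≡ck′ →
    selects (c k) k k′ k∈A k′∈A (∧-intro (A⊆Y k k∈A) (dec-true (c k ≟ c k) refl))
                                (∧-intro (A⊆Y k′ k′∈A) (dec-true (c k′ ≟ c k) (sym ck≡ck′)))

module IdealProperties {I : Family ℕ} (isIdeal : IsIdeal I) where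
  open IsIdeal isIdeal

  ⋃∈ : ∀ {A : Set} {F : A → Subset ℕ} → (∀ a → I (F a)) → ∀ as → I (⋃ F as)
  ⋃∈ F∈ []       = empty∈
  ⋃∈ F∈ (a ∷ as) = union _ _ (F∈ a) (⋃∈ F∈ as)

  Pos-cover : ∀ {A B C} → A ⊆ (B ∪ C) → Pos I A → I C → Pos I B
  Pos-cover A⊆B∪C posA C∈I B∈I = posA (down _ _ A⊆B∪C (union _ _ B∈I C∈I))

  finite∈ : (∀ n → I (fibre id n)) → ∀ A → Finite A → I A
  finite∈ singleton∈ A (m , beyond) = down _ _ below (⋃∈ singleton∈ (upTo m))
    where
    below : A ⊆ ⋃ (fibre id) (upTo m)
    below k k∈A =
      ∈-⋃ (upTo m) (Any.map (dec-true (k ≟ _)) (∈-upTo⁺ (≰⇒> λ m≤k → not-¬ k∈A (beyond k m≤k))))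

  colouring⇒ED≤K↾ : (X : Subset ℕ) (c : ℕ → ℕ) →
          (∀ n → I (X ∩ fibre c n)) →
          (∀ T → T ⊆ X → InjectiveOn c T → I T) →
          ED ≤K (I ↾ X)
  colouring⇒ED≤K↾ X c fibre∈ injective∈ = (λ e → c (proj₁ e) , proj₁ e) , preimage∈
    where
    graphOn : (ℕ → ℕ) → Subset ℕ
    graphOn g k = X k ∧ (g (c k) ≡ᵇ k)

    graphOn∈ : ∀ g → I (graphOn g)
    graphOn∈ g = injective∈ (graphOn g) (λ k → proj₁ ∘ ∧-elim) λ k k′ k∈ k′∈ ck≡ck′ →
      trans (sym (on-graph k k∈)) (trans (cong g ck≡ck′) (on-graph k′ k′∈))
      where
      on-graph : ∀ k → k ∈ₛ graphOn g → g (c k) ≡ k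
      on-graph k k∈ = does⇒ (g (c k) ≟ k) (proj₂ (∧-elim k∈))

    preimage∈ : ∀ A → ED A → I (extend X (λ e → A (c (proj₁ e) , proj₁ e)))
    preimage∈ A (cols , gs , covered) =
      down _ _ covers (union _ _ (⋃∈ fibre∈ cols) (⋃∈ graphOn∈ gs))
      where
      covers : extend X (λ e → A (c (proj₁ e) , proj₁ e)) ⊆ (⋃ (λ n → X ∩ fibre c n) cols ∪ ⋃ graphOn gs)
      covers k k∈ with extend-elim X _ k k∈
      ... | k∈X , ck,k∈A with covered (c k) k ck,k∈A
      ... | inj₁ ck∈cols = ∨-introˡ _ (∈-⋃ cols (Any.map (∧-intro k∈X ∘ dec-true (c k ≟ _)) ck∈cols))
      ... | inj₂ on-some-g = ∨-introʳ _ (∈-⋃ gs (Any.map (∧-intro k∈X ∘ dec-true (_ ≟ k)) on-some-g))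

  P⁺⇒finiteToOne : (∀ A → Finite A → I A) → IsPPlus I → ∀ {X} → Pos I X → (c : ℕ → ℕ) →
                   (∀ n → I (X ∩ fibre c n)) →
                   Σ (Subset ℕ) λ Y → Pos I Y × Y ⊆ X × FiniteToOneOn c Y
  P⁺⇒finiteToOne finite∈ pplus {X} posX c fibre∈ = shrink (pplus above above-pos above-decreasing)
    where
    above : ℕ → Subset ℕ
    above n = X ∩ (λ k → n ≤ᵇ c k)

    above-pos : ∀ n → Pos I (above n)
    above-pos zero    = Pos-cover (λ k k∈X → ∨-introˡ _ (∧-intro k∈X refl)) posX empty∈
    above-pos (suc n) = Pos-cover split (above-pos n) (fibre∈ n)
      where
      split : above n ⊆ (above (suc n) ∪ (X ∩ fibre c n))
      split k k∈ with ∧-elim k∈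
      ... | k∈X , n≤ck with m≤n⇒m<n∨m≡n (does⇒ (n ≤? c k) n≤ck)
      ... | inj₁ n<ck = ∨-introˡ _ (∧-intro k∈X (dec-true (suc n ≤? c k) n<ck))
      ... | inj₂ n≡ck = ∨-introʳ _ (∧-intro k∈X (dec-true (c k ≟ n) (sym n≡ck)))

    above-decreasing : ∀ n → above (suc n) ⊆ above n
    above-decreasing n k k∈ with ∧-elim k∈
    ... | k∈X , n<ck = ∧-intro k∈X (dec-true (n ≤? c k) (<⇒≤ (does⇒ (suc n ≤? c k) n<ck)))

    shrink : Σ (Subset ℕ) (λ Y → Pos I Y × (∀ n → Finite (Y ∖ above n))) →
             Σ (Subset ℕ) λ Y → Pos I Y × Y ⊆ X × FiniteToOneOn c Y
    shrink (Y , posY , almost⊆) = Y ∩ X , posY∩X , (λ k → proj₂ ∘ ∧-elim) , finite-fibres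
      where
      posY∩X : Pos I (Y ∩ X)
      posY∩X = Pos-cover Y⊆ posY (finite∈ _ (almost⊆ 0))
        where
        Y⊆ : Y ⊆ ((Y ∩ X) ∪ (Y ∖ above 0))
        Y⊆ k k∈Y with X k
        ... | true  = ∨-introˡ _ (∧-intro k∈Y refl)
        ... | false = ∨-introʳ _ (∧-intro k∈Y refl)

      finite-fibres : FiniteToOneOn c (Y ∩ X)
      finite-fibres n = IsIdeal.down Finite-isIdeal _ _ fibre⊆ (almost⊆ (suc n))
        where
        fibre⊆ : (Y ∩ X ∩ fibre c n) ⊆ (Y ∖ above (suc n))
        fibre⊆ k k∈ with ∧-elim k∈
        ... | k∈Y∩X , ck≡n = ∧-intro (proj₁ (∧-elim {Y k} k∈Y∩X)) (cong not k∉above)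
          where
          k∉above : above (suc n) k ≡ false
          k∉above = ¬-not λ k∈above → 1+n≰n (subst (suc n ≤_) (does⇒ (c k ≟ n) ck≡n)
                                               (does⇒ (suc n ≤? c k) (proj₂ (∧-elim {X k} k∈above))))

  selective⇒injectiveOn : (∀ A → Finite A → I A) → IsSelective I → ∀ {X} → Pos I X → (c : ℕ → ℕ) →
                          (∀ n → I (X ∩ fibre c n)) →
                          Σ (Subset ℕ) λ A → Pos I A × A ⊆ X × InjectiveOn c A
  selective⇒injectiveOn finite∈ (pplus , qplus) posX c fibre∈
    with P⁺⇒finiteToOne finite∈ pplus posX c fibre∈
  ... | Y , posY , Y⊆X , finite-fibres with Q⁺⇒injectiveOn qplus posY c finite-fibres
  ... | A , posA , A⊆Y , injective = A , posA , (λ k → Y⊆X k ∘ A⊆Y k) , injective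

increasing⇒monotone : ∀ {s : ℕ → ℕ} → (∀ n → s n < s (suc n)) → ∀ {m n} → m ≤ n → s m ≤ s n
increasing⇒monotone {s} increasing = go ∘ ≤⇒≤′
  where
  go : ∀ {m n} → m ≤′ n → s m ≤ s n
  go ≤′-refl        = ≤-refl
  go (≤′-step m≤′n) = ≤-trans (go m≤′n) (<⇒≤ (increasing _))

record Enumeration (A : Set) : Set where
  field
    enum      : ℕ → A
    enum-onto : ∀ a → Σ ℕ λ n → enum n ≡ a

open Enumeration

-- Walks each diagonal a + b = s from (0 , s) to (s , 0).
next : ℕ × ℕ → ℕ × ℕ
next (a , zero)  = 0 , suc a
next (a , suc b) = suc a , b

unpair : ℕ → ℕ × ℕ
unpair zero    = 0 , 0
unpair (suc n) = next (unpair n)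

unpair-onto : ∀ s a b → a + b ≡ s → Σ ℕ λ n → unpair n ≡ (a , b)
unpair-onto zero    zero    zero    _ = 0 , refl
unpair-onto (suc s) zero    (suc b) a+b≡s =
  let (n , n↦b,0) = unpair-onto s b zero (trans (+-identityʳ b) (suc-injective a+b≡s))
  in suc n , cong next n↦b,0
unpair-onto s       (suc a) b       a+b≡s =
  let (n , n↦a,1+b) = unpair-onto s a (suc b) (trans (+-suc a b) a+b≡s)
  in suc n , cong next n↦a,1+b

_×ₑ_ : ∀ {A B} → Enumeration A → Enumeration B → Enumeration (A × B)
eA ×ₑ eB = record
  { enum      = λ n → enum eA (proj₁ (unpair n)) , enum eB (proj₂ (unpair n))
  ; enum-onto = λ (a , b) →
      let (i , i↦a) = enum-onto eA a
          (j , j↦b) = enum-onto eB b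
          (n , n↦i,j) = unpair-onto (i + j) i j refl
      in n , trans (cong (λ (i , j) → enum eA i , enum eB j) n↦i,j) (cong₂ _,_ i↦a j↦b)
  }

mapₑ : ∀ {A B} (f : A → B) → (∀ b → Σ A λ a → f a ≡ b) → Enumeration A → Enumeration B
mapₑ f f-onto eA = record
  { enum      = f ∘ enum eA
  ; enum-onto = λ b →
      let (a , fa≡b) = f-onto b
          (n , n↦a) = enum-onto eA a
      in n , trans (cong f n↦a) fa≡b
  }

ℕ-enumeration : Enumeration ℕ
ℕ-enumeration = record { enum = id ; enum-onto = λ n → n , refl }

ℤ-enumeration : Enumeration ℤ
ℤ-enumeration = mapₑ (uncurry _⊖_) ⊖-onto (ℕ-enumeration ×ₑ ℕ-enumeration)
  where
  ⊖-onto : ∀ z → Σ (ℕ × ℕ) λ (m , n) → m ⊖ n ≡ z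
  ⊖-onto (+ n)    = (n , 0) , ⊖-≥ z≤n
  ⊖-onto -[1+ n ] = (0 , suc n) , refl

ℚ-enumeration : Enumeration ℚ
ℚ-enumeration = mapₑ (uncurry λ z d → z / suc d) (λ p → (↥ p , ℚ.denominator-1 p) , ℚP.↥p/↧p≡p p)
                     (ℤ-enumeration ×ₑ ℕ-enumeration)

dense⇒¬nwd : ∀ {B : Subset ℚ} → (∀ {r s} → r <ℚ s → Σ ℚ λ x → r <ℚ x × x <ℚ s × x ∈ₛ B) → ¬ nwd B
dense⇒¬nwd dense nwd-B =
  let (r , s , _ , r<s , _ , avoids) = nwd-B 0ℚ 1ℚ (ℚP.positive⁻¹ 1ℚ)
      (x , r<x , x<s , x∈B) = dense r<s
  in not-¬ x∈B (avoids x r<x x<s)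

nwd-sublevels⇒unbounded : (f : ℚ → ℕ) → (∀ N → nwd (λ x → f x ≤ᵇ N)) →
                          ∀ {p q} → p <ℚ q → ∀ N → Σ ℚ λ x → p <ℚ x × x <ℚ q × N < f x
nwd-sublevels⇒unbounded f nwd-sublevel {p} {q} p<q N =
  let (r , s , p≤r , r<s , s≤q , avoids) = nwd-sublevel N p q p<q
      (x , r<x , x<s) = ℚP.<-dense r<s
  in x , ℚP.≤-<-trans p≤r r<x , ℚP.<-≤-trans x<s s≤q ,
     ≰⇒> λ fx≤N → not-¬ (dec-true (f x ≤? N) fx≤N) (avoids x r<x x<s)

initial-segment-finite : ∀ N → Finite (λ k → k ≤ᵇ N)
initial-segment-finite N = suc N , λ k N<k → dec-false (k ≤? N) (<⇒≱ N<k)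

module Classical (lem : ExcludedMiddle 0ℓ) where

  dne : {P : Set} → ¬ ¬ P → P
  dne = em⇒dne lem

  minimum-or-none : (p : ℕ → Bool) → Minimum p ⊎ (∀ n → p n ≡ false)
  minimum-or-none p with lem {Σ ℕ λ n → p n ≡ true}
  ... | yes (n , pn) = inj₁ (minimum p n pn)
  ... | no  none     = inj₂ λ n → ¬-not λ pn → none (n , pn)

  subsingleton⇒Finite : ∀ {A} → (∀ k k′ → k ∈ₛ A → k′ ∈ₛ A → k ≡ k′) → Finite A
  subsingleton⇒Finite {A} unique with lem {Σ ℕ λ k → k ∈ₛ A}
  ... | yes (k₀ , k₀∈A) = suc k₀ , λ k k₀<k → ¬-not λ k∈A → <⇒≢ k₀<k (unique k₀ k k₀∈A k∈A)
  ... | no  empty       = 0 , λ k _ → ¬-not λ k∈A → empty (k , k∈A)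

  injectiveOn⇒finite-below : ∀ {c S} → InjectiveOn c S → ∀ n → Finite (S ∩ (λ k → c k ≤ᵇ n))
  injectiveOn⇒finite-below {c} {S} injective n = down _ _ below (⋃∈ fibre-finite (upTo (suc n)))
    where
    open IsIdeal Finite-isIdeal
    open IdealProperties Finite-isIdeal

    fibre-finite : ∀ j → Finite (S ∩ fibre c j)
    fibre-finite j = subsingleton⇒Finite λ k k′ k∈ k′∈ →
      injective k k′ (proj₁ (∧-elim k∈)) (proj₁ (∧-elim k′∈)) (trans (on-fibre k∈) (sym (on-fibre k′∈)))
      where
      on-fibre : ∀ {k} → k ∈ₛ (S ∩ fibre c j) → c k ≡ j
      on-fibre {k} k∈ = does⇒ (c k ≟ j) (proj₂ (∧-elim {S k} k∈))

    below : (S ∩ (λ k → c k ≤ᵇ n)) ⊆ ⋃ (λ j → S ∩ fibre c j) (upTo (suc n))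
    below k k∈ with ∧-elim k∈
    ... | k∈S , ck≤n = ∈-⋃ (upTo (suc n))
      (Any.map (∧-intro k∈S ∘ dec-true (c k ≟ _)) (∈-upTo⁺ (s≤s (does⇒ (c k ≤? n) ck≤n))))

  injectiveOn⇒retraction : ∀ {c A} → InjectiveOn c A → Σ (ℕ → ℕ) λ r → ∀ k → k ∈ₛ A → r (c k) ≡ k
  injectiveOn⇒retraction {c} {A} injective = r , r-retracts
    where
    Preimage : ℕ → Set
    Preimage n = Σ ℕ λ k → k ∈ₛ A × c k ≡ n

    some : ∀ {n} → Dec (Preimage n) → ℕ
    some (yes (k , _)) = k
    some (no _)        = 0

    r : ℕ → ℕ
    r n = some (lem {Preimage n})

    r-retracts : ∀ k → k ∈ₛ A → r (c k) ≡ k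
    r-retracts k k∈A with lem {Preimage (c k)}
    ... | yes (k′ , k′∈A , ck′≡ck) = injective k′ k k′∈A k∈A ck′≡ck
    ... | no  none                 = contradiction (k , k∈A , refl) none

  split-unbounded-family : (W : ℕ → ℕ → Set) → (∀ m N → Σ ℕ λ k → N < k × W m k) →
                           Σ (Subset ℕ) λ A → ∀ m bit → Σ ℕ λ k → W m k × A k ≡ bit
  split-unbounded-family W unbounded = A , splits
    where
    pick : ℕ → ℕ → ℕ
    pick m N = proj₁ (unbounded m N)

    a b : ℕ → ℕ
    a zero    = pick 0 0
    a (suc m) = pick (suc m) (b m)
    b m = pick m (a m)

    a<b : ∀ m → a m < b m
    a<b m = proj₁ (proj₂ (unbounded m (a m)))

    b<a : ∀ m → b m < a (suc m)
    b<a m = proj₁ (proj₂ (unbounded (suc m) (b m)))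

    a-monotone : ∀ {m n} → m ≤ n → a m ≤ a n
    a-monotone = increasing⇒monotone λ m → <-trans (a<b m) (b<a m)

    a≢b : ∀ m′ m → a m′ ≢ b m
    a≢b m′ m with m′ ≤? m
    ... | yes m′≤m = <⇒≢ (≤-<-trans (a-monotone m′≤m) (a<b m))
    ... | no  m′≰m = ≢-sym (<⇒≢ (<-≤-trans (b<a m) (a-monotone (≰⇒> m′≰m))))

    A : Subset ℕ
    A k = does (lem {Σ ℕ λ m → a m ≡ k})

    a∈W : ∀ m → W m (a m)
    a∈W zero    = proj₂ (proj₂ (unbounded 0 0))
    a∈W (suc m) = proj₂ (proj₂ (unbounded (suc m) (b m)))

    splits : ∀ m bit → Σ ℕ λ k → W m k × A k ≡ bit
    splits m true  = a m , a∈W m , dec-true lem (m , refl)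
    splits m false = b m , proj₂ (proj₂ (unbounded m (a m))) ,
                     dec-false lem λ (m′ , a[m′]≡b[m]) → a≢b m′ m a[m′]≡b[m]

  maximal⇒¬≤K-nwd : ∀ {I} → IsMaximal I → (∀ A → Finite A → I A) → ¬ (I ≤K nwd)
  maximal⇒¬≤K-nwd {I} maximal finite∈ (f , f-pre) =
    refute (split-unbounded-family (Hits ∘ enum intervals) (hits-unbounded ∘ enum intervals))
    where
    intervals : Enumeration (ℚ × ℚ)
    intervals = ℚ-enumeration ×ₑ ℚ-enumeration

    Hits : ℚ × ℚ → ℕ → Set
    Hits (r , s) k = r <ℚ s → Σ ℚ λ x → r <ℚ x × x <ℚ s × f x ≡ k

    hits-unbounded : ∀ i N → Σ ℕ λ k → N < k × Hits i k
    hits-unbounded (r , s) N with r ℚP.<? s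
    ... | yes r<s = let (x , r<x , x<s , N<fx) = nwd-sublevels⇒unbounded f sublevels-nwd r<s N
                    in f x , N<fx , λ _ → x , r<x , x<s , refl
      where
      sublevels-nwd : ∀ N → nwd (λ x → f x ≤ᵇ N)
      sublevels-nwd N = f-pre _ (finite∈ _ (initial-segment-finite N))
    ... | no  r≮s = suc N , ≤-refl , λ r<s → contradiction r<s r≮s

    refute : (Σ (Subset ℕ) λ A → ∀ m bit → Σ ℕ λ k → Hits (enum intervals m) k × A k ≡ bit) → ⊥
    refute (A , splits) =
      [ dense⇒¬nwd (meets true) ∘ f-pre A , dense⇒¬nwd meets-compl ∘ f-pre (compl A) ]′ (maximal A)
      where
      meets : ∀ bit {r s} → r <ℚ s → Σ ℚ λ x → r <ℚ x × x <ℚ s × A (f x) ≡ bit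
      meets bit {r} {s} r<s =
        let (m , m↦r,s) = enum-onto intervals (r , s)
            (k , hits , Ak≡bit) = splits m bit
            (x , r<x , x<s , fx≡k) = subst (λ i → Hits i k) m↦r,s hits r<s
        in x , r<x , x<s , trans (cong A fx≡k) Ak≡bit

      meets-compl : ∀ {r s} → r <ℚ s → Σ ℚ λ x → r <ℚ x × x <ℚ s × compl A (f x) ≡ true
      meets-compl r<s = let (x , r<x , x<s , fx∉A) = meets false r<s in x , r<x , x<s , cong not fx∉A

  module _ {I : Family ℕ} (isIdeal : IsIdeal I) where
    open IsIdeal isIdeal
    open IdealProperties isIdeal

    selective⇒¬ED≤K↾ : (∀ A → Finite A → I A) → IsSelective I → ∀ {X} → Pos I X → ¬ (ED ≤K (I ↾ X))
    selective⇒¬ED≤K↾ finite∈ selective {X} posX (f , f-pre) =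
      refute (selective⇒injectiveOn finite∈ selective posX (proj₁ ∘ F) λ n → pre∈ (column n) (column∈ED n))
      where
      F : ℕ → ℕ × ℕ
      F = totalise X (0 , 0) f

      pre∈ : ∀ B → ED B → I (X ∩ (B ∘ F))
      pre∈ B B∈ED = down _ _ (λ k k∈ → trans (extend-totalise X (0 , 0) f B k) k∈) (f-pre B B∈ED)

      refute : (Σ (Subset ℕ) λ A → Pos I A × A ⊆ X × InjectiveOn (proj₁ ∘ F) A) → ⊥
      -- On A the second coordinate of F is a function g of the first, so A lies in the
      -- preimage of the graph of g.
      refute (A , posA , A⊆X , injective) =
        let (r , r-retracts) = injectiveOn⇒retraction injective
            g = proj₂ ∘ F ∘ r
            A⊆preimage : A ⊆ (X ∩ (graph g ∘ F))
            A⊆preimage k k∈A = ∧-intro (A⊆X k k∈A)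
              (dec-true (g (proj₁ (F k)) ≟ proj₂ (F k)) (cong (proj₂ ∘ F) (r-retracts k k∈A)))
        in posA (down _ _ A⊆preimage (pre∈ (graph g) (graph∈ED g)))

    ¬ED≤K↾⇒Q⁺ : (∀ A → Finite A → I A) → ¬ ED≤K↾Pos I → IsQPlus I
    ¬ED≤K↾⇒Q⁺ finite∈ ¬ED X P posX finite disjoint covers _ = dne λ no-selector →
      ¬ED (X , posX , colouring⇒ED≤K↾ X c fibre∈ λ T T⊆X injective → dne λ posT →
        no-selector (T , posT , T⊆X , selects T⊆X injective))
      where
      c : ℕ → ℕ
      c = totalise X 0 (λ e → proj₁ (covers (proj₁ e) (proj₂ e)))

      in-piece : ∀ k → k ∈ₛ X → k ∈ₛ P (c k)
      in-piece = totalise-spec X 0 _ (λ k n → k ∈ₛ P n) (λ e → proj₂ (covers (proj₁ e) (proj₂ e)))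

      piece : ∀ {n k} → k ∈ₛ X → k ∈ₛ P n → c k ≡ n
      piece {n} {k} k∈X k∈Pn with c k ≟ n
      ... | yes ck≡n = ck≡n
      ... | no  ck≢n = ⊥-elim (disjoint (c k) n k ck≢n (in-piece k k∈X) k∈Pn)

      fibre∈ : ∀ n → I (X ∩ fibre c n)
      fibre∈ n = finite∈ _ (IsIdeal.down Finite-isIdeal _ _ fibre⊆piece (finite n))
        where
        fibre⊆piece : (X ∩ fibre c n) ⊆ P n
        fibre⊆piece k k∈ with ∧-elim k∈
        ... | k∈X , ck≡n = subst (λ m → k ∈ₛ P m) (does⇒ (c k ≟ n) ck≡n) (in-piece k k∈X)

      selects : ∀ {T} → T ⊆ X → InjectiveOn c T →
                ∀ n k k′ → k ∈ₛ T → k′ ∈ₛ T → k ∈ₛ P n → k′ ∈ₛ P n → k ≡ k′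
      selects T⊆X injective n k k′ k∈T k′∈T k∈Pn k′∈Pn =
        injective k k′ k∈T k′∈T (trans (piece (T⊆X k k∈T) k∈Pn) (sym (piece (T⊆X k′ k′∈T) k′∈Pn)))

    ¬ED≤K↾⇒P⁺ : IsMaximal I → ¬ (ED ≤K (I ↾ fullₛ)) → IsPPlus I
    -- The sequence need not be decreasing for this argument.
    ¬ED≤K↾⇒P⁺ maximal ¬ED Xs Xs-pos _ = dne (¬ED ∘ level-colouring)
      where
      exit : ∀ k → Minimum (λ n → not (Xs n k)) ⊎ (∀ n → not (Xs n k) ≡ false)
      exit k = minimum-or-none (λ n → not (Xs n k))

      level : ℕ → ℕ
      level k = [ proj₁ , const 0 ]′ (exit k)

      ⋂Xs : Subset ℕ
      ⋂Xs k = [ const false , const true ]′ (exit k)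

      ⋂Xs-almost⊆ : ∀ n → Finite (⋂Xs ∖ Xs n)
      ⋂Xs-almost⊆ n = 0 , λ k _ → ¬-not λ k∈ →
        not-¬ (⋂⊆ k (proj₁ (∧-elim k∈))) (not-true (proj₂ (∧-elim k∈)))
        where
        ⋂⊆ : ⋂Xs ⊆ Xs n
        ⋂⊆ k k∈⋂ with exit k
        ... | inj₁ _           = contradiction k∈⋂ λ ()
        ... | inj₂ never-exits = not-false (never-exits n)

      level-fibre∈ : I ⋂Xs → ∀ n → I (fullₛ ∩ fibre level n)
      level-fibre∈ ⋂Xs∈I n = down _ _ fibre⊆ (union _ _ ⋂Xs∈I compl∈)
        where
        compl∈ : I (compl (Xs n))
        compl∈ with maximal (Xs n)
        ... | inj₁ Xs∈I  = contradiction Xs∈I (Xs-pos n)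
        ... | inj₂ compl∈ = compl∈

        fibre⊆ : fibre level n ⊆ (⋂Xs ∪ compl (Xs n))
        fibre⊆ k level≡n with exit k
        ... | inj₁ (m , exits , _) = subst (λ j → not (Xs j k) ≡ true) (does⇒ (m ≟ n) level≡n) exits
        ... | inj₂ _               = refl

      outside-below : ∀ T n → (T ∖ Xs n) ⊆ (T ∩ (λ k → level k ≤ᵇ n))
      outside-below T n k k∈ with ∧-elim k∈ | exit k
      ... | k∈T , k∉Xs | inj₁ (_ , _ , least) = ∧-intro k∈T (dec-true (_ ≤? n) (least n k∉Xs))
      ... | _   , k∉Xs | inj₂ never-exits      = contradiction k∉Xs (not-¬ (never-exits n))

      level-colouring : ¬ (Σ (Subset ℕ) λ T → Pos I T × (∀ n → Finite (T ∖ Xs n))) → ED ≤K (I ↾ fullₛ)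
      level-colouring no-pseudointersection =
        colouring⇒ED≤K↾ fullₛ level (level-fibre∈ (pseudointersection∈ ⋂Xs ⋂Xs-almost⊆)) λ T _ injective →
          pseudointersection∈ T λ n →
            IsIdeal.down Finite-isIdeal _ _ (outside-below T n) (injectiveOn⇒finite-below injective n)
        where
        pseudointersection∈ : ∀ T → (∀ n → Finite (T ∖ Xs n)) → I T
        pseudointersection∈ T almost⊆ = dne λ posT → no-pseudointersection (T , posT , almost⊆)

module _ {U : Family ℕ} (uf : IsNonprincipalUltrafilter U) where
  open IsNonprincipalUltrafilter uf

  dual-isIdeal : IsIdeal (dual U)
  dual-isIdeal = record
    { empty∈ = full∈
    ; full∉  = empty∉
    ; down   = λ A B A⊆B → up _ _ λ k k∉B → cong not (¬-not λ k∈A → not-¬ (A⊆B k k∈A) (not-true k∉B))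
    ; union  = λ A B Aᶜ∈U Bᶜ∈U → up _ _ (λ k k∉A∪B →
                 let (k∉A , k∉B) = ∧-elim {not (A k)} k∉A∪B in cong not (∨-false (not-true k∉A) (not-true k∉B)))
                 (inter _ _ Aᶜ∈U Bᶜ∈U)
    }

  dual-maximal : IsMaximal (dual U)
  dual-maximal A with ultra A
  ... | inj₁ A∈U  = inj₂ (up _ _ (λ k k∈A → trans (not-involutive (A k)) k∈A) A∈U)
  ... | inj₂ Aᶜ∈U = inj₁ Aᶜ∈U

  dual-finite∈ : ∀ A → Finite A → dual U A
  dual-finite∈ = IdealProperties.finite∈ dual-isIdeal singleton∈
    where
    singleton∈ : ∀ n → dual U (fibre id n)
    singleton∈ n with ultra (fibre id n)
    ... | inj₁ singleton∈U = contradiction singleton∈U (nonprinc n)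
    ... | inj₂ complement∈U = complement∈U

mainTheorem12 : ExcludedMiddle 0ℓ →
    ((∀ (U : Family ℕ) → IsNonprincipalUltrafilter U →
        (dual U ≤K nwd) ⊎ (Σ (Subset ℕ) λ X → Pos (dual U) X × (ED ≤K (dual U ↾ X))))
     ⇔ (¬ (Σ (Family ℕ) λ U → IsRamsey U)))
mainTheorem12 lem = mk⇔ no-Ramsey all-Katětov-above
  where
  open Classical lem

  no-Ramsey : (∀ U → IsNonprincipalUltrafilter U → (dual U ≤K nwd) ⊎ ED≤K↾Pos (dual U)) →
              ¬ (Σ (Family ℕ) IsRamsey)
  no-Ramsey dichotomy (U , uf , selective) =
    [ maximal⇒¬≤K-nwd (dual-maximal uf) (dual-finite∈ uf)
    , (λ (X , posX , ED≤) → selective⇒¬ED≤K↾ (dual-isIdeal uf) (dual-finite∈ uf) selective posX ED≤)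
    ]′ (dichotomy U uf)

  all-Katětov-above : ¬ (Σ (Family ℕ) IsRamsey) →
                      ∀ U → IsNonprincipalUltrafilter U → (dual U ≤K nwd) ⊎ ED≤K↾Pos (dual U)
  all-Katětov-above ¬Ramsey U uf with lem {ED≤K↾Pos (dual U)}
  ... | yes ED≤ = inj₂ ED≤
  ... | no  ¬ED = contradiction (U , uf , P⁺ , Q⁺) ¬Ramsey
    where
    P⁺ : IsPPlus (dual U)
    P⁺ = ¬ED≤K↾⇒P⁺ (dual-isIdeal uf) (dual-maximal uf) λ ED≤ →
           ¬ED (fullₛ , IsIdeal.full∉ (dual-isIdeal uf) , ED≤)

    Q⁺ : IsQPlus (dual U)
    Q⁺ = ¬ED≤K↾⇒Q⁺ (dual-isIdeal uf) (dual-finite∈ uf) ¬ED
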